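{- For every hypergraph $H$, $b_L(H)\leq b(H)$.
   Context: A hypergraph $H$ consists of a nonempty finite vertex set $V(H)$ and a finite family $E(H)$ of edges, each a subset of $V(H)$ (parallel edges permitted). Round-based burning: let $F_0=\emptyset$. In each round $r=1,2,\ldots$ the following happen simultaneously: every vertex $v\notin F_{r-1}$ for which there is an edge $e$ with $|e|\geq 2$, $v\in e$ and $e\setminus\{v\}\subseteq F_{r-1}$ catches fire; and a chosen vertex $u_r\notin F_{r-1}$ (a source) is set on fire. $F_r$ is $F_{r-1}$ together with all vertices set on fire in round $r$. A sequence $(u_1,\ldots,u_k)$ with $u_r\notin F_{r-1}$ for all $r$ and $F_k=V(H)$ is a burning sequence; the burning number $b(H)$ is the minimum length of a burning sequence. Lazy burning: a set $S\subseteq V(H)$ is set on fire; then repeatedly any unburned vertex $v$ lying in an edge $e$ with $|e|\geq 2$ such that all vertices of $e\setminus\{v\}$ are on fire catches fire; $S$ is a lazy burning set if eventually all vertices are on fire; $b_L(H)$ is the minimum size of a lazy burning set. -}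

module Defs where

open import Data.Nat using (ℕ; zero; suc; _≤_)
open import Data.Fin using (Fin; toℕ)
open import Data.Fin.Subset using (Subset; _∈_; ∣_∣)
open import Data.List using (List)
open import Data.List.Membership.Propositional using () renaming (_∈_ to _∈ₗ_)
open import Data.Vec using (Vec; lookup)
open import Data.Product using (_×_)
open import Relation.Nullary using (¬_)
open import Relation.Binary.PropositionalEquality using (_≡_; _≢_)

-- A hypergraph: vertex set Fin n (nonempty, n ≥ 1) and a finite family
-- (list, so parallel edges are allowed) of edges, each a subset of the vertices.
record Hypergraph : Set where
  field
    n        : ℕ
    nonempty : 1 ≤ n
    edges    : List (Subset n)

open Hypergraph public

-- Round-based burning with source sequence us = (u_1, …, u_k) (u_{r+1} = lookup us r).
-- InF H us r v  means  v ∈ F_r.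
data InF (H : Hypergraph) {k : ℕ} (us : Vec (Fin (n H)) k) : ℕ → Fin (n H) → Set where
  old    : ∀ {r v} → InF H us r v → InF H us (suc r) v
  source : (r : Fin k) → InF H us (suc (toℕ r)) (lookup us r)
  spread : ∀ {r v} (e : Subset (n H)) → e ∈ₗ edges H → v ∈ e → 2 ≤ ∣ e ∣ →
           (∀ w → w ∈ e → w ≢ v → InF H us r w) → InF H us (suc r) v

IsBurningSequence : (H : Hypergraph) {k : ℕ} → Vec (Fin (n H)) k → Set
IsBurningSequence H {k} us =
  (∀ (r : Fin k) → ¬ InF H us (toℕ r) (lookup us r)) × (∀ v → InF H us k v)

data LazyBurnt (H : Hypergraph) (S : Subset (n H)) : Fin (n H) → Set where
  seed   : ∀ {v} → v ∈ S → LazyBurnt H S v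
  spread : ∀ {v} (e : Subset (n H)) → e ∈ₗ edges H → v ∈ e → 2 ≤ ∣ e ∣ →
           (∀ w → w ∈ e → w ≢ v → LazyBurnt H S w) → LazyBurnt H S v

IsLazyBurningSet : (H : Hypergraph) → Subset (n H) → Set
IsLazyBurningSet H S = ∀ v → LazyBurnt H S v

module Submission where

open import Defs
open import Data.Nat using (ℕ; suc; _≤_; _+_; z≤n; s≤s)
open import Data.Nat.Properties using (≤-trans; ≤-reflexive; +-suc; m≤n⇒m≤1+n; module ≤-Reasoning)
open import Data.Fin using (Fin)
open import Data.Fin.Subset using (Subset; ∣_∣; _∈_; _∪_; ⊥; ⁅_⁆; inside; outside)
open import Data.Fin.Subset.Properties using (∣⊥∣≡0; ∣⁅x⁆∣≡1; x∈⁅x⁆; x∈p∪q⁺)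
open import Data.Vec using (Vec; []; _∷_; lookup)
open import Data.Product using (Σ; _×_; _,_)
open import Data.Sum using (inj₁; inj₂)
open import Relation.Binary.PropositionalEquality using (cong; sym)

-- Every vertex burnt in the round-based process is a source or is ignited by the
-- edge rule that also drives lazy burning, so the set of the k sources is a lazy
-- burning set.

∣p∪q∣≤∣p∣+∣q∣ : ∀ {m} (p q : Subset m) → ∣ p ∪ q ∣ ≤ ∣ p ∣ + ∣ q ∣
∣p∪q∣≤∣p∣+∣q∣ []            []            = z≤n
∣p∪q∣≤∣p∣+∣q∣ (outside ∷ p) (outside ∷ q) = ∣p∪q∣≤∣p∣+∣q∣ p q
∣p∪q∣≤∣p∣+∣q∣ (inside  ∷ p) (outside ∷ q) = s≤s (∣p∪q∣≤∣p∣+∣q∣ p q)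
∣p∪q∣≤∣p∣+∣q∣ (outside ∷ p) (inside  ∷ q) =
  ≤-trans (s≤s (∣p∪q∣≤∣p∣+∣q∣ p q)) (≤-reflexive (sym (+-suc ∣ p ∣ ∣ q ∣)))
∣p∪q∣≤∣p∣+∣q∣ (inside  ∷ p) (inside  ∷ q) =
  s≤s (≤-trans (m≤n⇒m≤1+n (∣p∪q∣≤∣p∣+∣q∣ p q)) (≤-reflexive (sym (+-suc ∣ p ∣ ∣ q ∣))))

sources : ∀ {m k} → Vec (Fin m) k → Subset m
sources []       = ⊥
sources (u ∷ us) = ⁅ u ⁆ ∪ sources us

∣sources∣≤length : ∀ {m k} (us : Vec (Fin m) k) → ∣ sources us ∣ ≤ k
∣sources∣≤length {m} [] = ≤-reflexive (∣⊥∣≡0 m)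
∣sources∣≤length {k = suc k} (u ∷ us) = begin
  ∣ ⁅ u ⁆ ∪ sources us ∣     ≤⟨ ∣p∪q∣≤∣p∣+∣q∣ ⁅ u ⁆ (sources us) ⟩
  ∣ ⁅ u ⁆ ∣ + ∣ sources us ∣ ≡⟨ cong (_+ ∣ sources us ∣) (∣⁅x⁆∣≡1 u) ⟩
  1 + ∣ sources us ∣         ≤⟨ s≤s (∣sources∣≤length us) ⟩
  1 + k                      ∎
  where open ≤-Reasoning

lookup∈sources : ∀ {m k} (us : Vec (Fin m) k) r → lookup us r ∈ sources us
lookup∈sources (u ∷ us) Fin.zero    = x∈p∪q⁺ (inj₁ (x∈⁅x⁆ u))
lookup∈sources (u ∷ us) (Fin.suc r) = x∈p∪q⁺ (inj₂ (lookup∈sources us r))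

InF⇒LazyBurnt : ∀ H {k} (us : Vec (Fin (n H)) k) {r v} →
  InF H us r v → LazyBurnt H (sources us) v
InF⇒LazyBurnt H us (old burnt)   = InF⇒LazyBurnt H us burnt
InF⇒LazyBurnt H us (source r)    = seed (lookup∈sources us r)
InF⇒LazyBurnt H us (spread e e∈E v∈e 2≤∣e∣ rest) =
  spread e e∈E v∈e 2≤∣e∣ (λ w w∈e w≢v → InF⇒LazyBurnt H us (rest w w∈e w≢v))

mainTheorem2 : (H : Hypergraph) (k : ℕ) (us : Vec (Fin (n H)) k) →
    IsBurningSequence H us →
    Σ (Subset (n H)) (λ S → IsLazyBurningSet H S × ∣ S ∣ ≤ k)
mainTheorem2 H k us (_ , allBurnt) =
  sources us , (λ v → InF⇒LazyBurnt H us (allBurnt v)) , ∣sources∣≤length us
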